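{- Let $G \in \mathcal{C}$, let $S$ be a minimal separator of $G$, and let $L, R$ be two distinct full components of $S$. Let $Z \subseteq L$ be a clique with $S \subseteq N(Z)$ such that for every $z \in Z$ the set $(N(z)\cap S) \setminus N(Z \setminus \{z\})$ is nonempty, and let $Z' \subseteq R$ be a clique with $S \subseteq N(Z')$ such that for every $z \in Z'$ the set $(N(z)\cap S)\setminus N(Z'\setminus\{z\})$ is nonempty. For $z \in Z$ let $f(z) \in (N(z)\cap S)\setminus N(Z\setminus\{z\})$ and let $g(z)$ be a neighbor of $f(z)$ in $R$; for $z \in Z'$ let $f(z) \in (N(z)\cap S)\setminus N(Z'\setminus\{z\})$ and let $g(z)$ be a neighbor of $f(z)$ in $L$. Then for every $x \in S$ and every $z \in Z \cup Z'$, we have $N(x) \cap \{z, f(z), g(z)\} \neq \emptyset$.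
   Context: A hole is an induced cycle of length at least $4$. An extended $C_5$ is a six-vertex graph obtained from a five-vertex hole by adding a vertex adjacent to exactly one vertex or exactly two consecutive vertices of the hole. $\mathcal{C}$ is the class of graphs with no hole of length at least $6$ and no extended $C_5$ as an induced subgraph. $N(X)$ is the open neighborhood of $X$ (for a vertex $x$, $N(x)=N(\{x\})$). A set $S$ is a minimal separator if $G-S$ has at least two connected components $D$ with $N(D)=S$; these are the full components of $S$. -}

module Defs where

open import Data.Nat using (ℕ; zero; suc; _≤_)
open import Data.Fin using (Fin; toℕ)
open import Data.Fin.Subset using (Subset; _∈_; _∉_; _─_; ⁅_⁆)
open import Data.Bool using (Bool; T)
open import Data.Product using (Σ; ∃; _×_; _,_)
open import Data.Sum using (_⊎_)
open import Data.Empty using (⊥)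
open import Relation.Nullary using (¬_)
open import Relation.Binary.PropositionalEquality using (_≡_)
open import Function.Bundles using (_⇔_)
open import Level using (0ℓ)

record Graph (n : ℕ) : Set where
  field
    adj     : Fin n → Fin n → Bool
    symm    : ∀ u v → adj u v ≡ adj v u
    irrefl  : ∀ u → ¬ T (adj u u)

module _ {n : ℕ} (G : Graph n) where
  open Graph G

  Adj : Fin n → Fin n → Set
  Adj u v = T (adj u v)

  CycAdj : (k : ℕ) → Fin k → Fin k → Set
  CycAdj k i j =
      (suc (toℕ i) ≡ toℕ j)
    ⊎ (suc (toℕ j) ≡ toℕ i)
    ⊎ (toℕ i ≡ 0 × suc (toℕ j) ≡ k)
    ⊎ (toℕ j ≡ 0 × suc (toℕ i) ≡ k)

  IsHole : (k : ℕ) → (Fin k → Fin n) → Set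
  IsHole k v =
      (4 ≤ k)
    × (∀ i j → v i ≡ v j → i ≡ j)
    × (∀ i j → Adj (v i) (v j) ⇔ CycAdj k i j)

  HasExtendedC5 : Set
  HasExtendedC5 =
    Σ (Fin 5 → Fin n) λ v → Σ (Fin n) λ u →
      IsHole 5 v × (∀ i → ¬ (u ≡ v i)) ×
      ( (∃ λ i → ∀ l → Adj u (v l) ⇔ (l ≡ i))
      ⊎ (Σ (Fin 5) λ i → Σ (Fin 5) λ j → CycAdj 5 i j ×
           (∀ l → Adj u (v l) ⇔ (l ≡ i ⊎ l ≡ j))) )

  InClassC : Set
  InClassC =
    (∀ k (v : Fin k → Fin n) → 6 ≤ k → ¬ IsHole k v) × ¬ HasExtendedC5

  N : Subset n → Fin n → Set
  N X v = v ∉ X × Σ (Fin n) λ x → x ∈ X × Adj x v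

  data WalkIn (D : Subset n) : Fin n → Fin n → Set where
    here : ∀ {u} → u ∈ D → WalkIn D u u
    step : ∀ {u v w} → u ∈ D → Adj u v → WalkIn D v w → WalkIn D u w

  ConnectedSet : Subset n → Set
  ConnectedSet D = ∀ u v → u ∈ D → v ∈ D → WalkIn D u v

  IsComponent : Subset n → Subset n → Set
  IsComponent S D =
      (∃ λ v → v ∈ D)
    × (∀ v → v ∈ D → v ∉ S)
    × ConnectedSet D
    × (∀ u v → u ∈ D → v ∉ S → Adj u v → v ∈ D)

  IsFullComponent : Subset n → Subset n → Set
  IsFullComponent S D = IsComponent S D × (∀ v → v ∈ S ⇔ N D v)

  IsMinimalSeparator : Subset n → Set
  IsMinimalSeparator S =
    Σ (Subset n) λ D₁ → Σ (Subset n) λ D₂ →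
      IsFullComponent S D₁ × IsFullComponent S D₂ × ¬ (D₁ ≡ D₂)

  IsClique : Subset n → Set
  IsClique Z = ∀ x y → x ∈ Z → y ∈ Z → ¬ (x ≡ y) → Adj x y

  Private : Subset n → Subset n → Fin n → Fin n → Set
  Private S Z z s = Adj z s × s ∈ S × ¬ N (Z ─ ⁅ z ⁆) s

-- Suppose x ∈ S misses z, f(z) and g(z), say with z ∈ Z ⊆ L. Since S ⊆ N(Z), x has a
-- neighbour z₁ ∈ Z, and z₁ ≠ z is adjacent to z but not to the private neighbour f(z).
-- As R is a full component, a shortest path through R from a neighbour of f(z) to a
-- neighbour of x is induced and touches N(f(z)) and N(x) only at its ends; closed up by
-- x z₁ z f(z) it is a hole, because z₁, z ∈ L see nothing in R. Holes of length ≥ 6 are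
-- excluded, so the path is a single vertex r and x z₁ z f(z) r is a 5-hole; then g(z) ∈ R
-- sees f(z), possibly r, and nothing else on it, which is an extended C₅.
module Submission where

open import Defs
open import Data.Nat using (ℕ; zero; suc; _+_; _∸_; _≤_; _<_; z≤n; s≤s; compare; less; equal; greater)
open import Data.Nat.Properties
open import Data.Nat.Induction using (<-rec)
open import Data.Fin using (Fin; toℕ) renaming (zero to fz; suc to fs)
open import Data.Fin.Properties using (toℕ-injective; toℕ<n) renaming (_≟_ to _≟ᶠ_)
open import Data.Fin.Subset using (Subset; _∈_; _∉_; _⊆_; _─_; ⁅_⁆)
open import Data.Fin.Subset.Properties using (⊆-antisym; x∈p∧x∉q⇒x∈p─q; p─q⊆p; x≢y⇒x∉⁅y⁆)
open import Data.Bool using (T)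
open import Data.Product using (Σ; ∃; _×_; _,_; proj₁; proj₂)
open import Data.Sum using (_⊎_; inj₁; inj₂)
open import Data.Empty using (⊥; ⊥-elim)
open import Relation.Nullary using (¬_; Dec; yes; no)
open import Relation.Nullary.Decidable using (T?; _×-dec_)
open import Relation.Unary using (Decidable)
open import Relation.Binary.PropositionalEquality using (_≡_; _≢_; refl; sym; cong; subst)
open import Function.Bundles using (Equivalence; mk⇔)

module _ {n} (G : Graph n) where

  Adj-sym : ∀ {u v} → Adj G u v → Adj G v u
  Adj-sym {u} {v} = subst T (Graph.symm G u v)

  Adj? : ∀ u → Decidable (Adj G u)
  Adj? u v = T? (Graph.adj G u v)

  Adj⇒≢ : ∀ {u v} → Adj G u v → u ≢ v
  Adj⇒≢ {u} u~u refl = Graph.irrefl G u u~u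

module _ {n} {G : Graph n} {S : Subset n} where

  walk-stays-in-component : ∀ {C D a b} → IsComponent G S D → (∀ v → v ∈ C → v ∉ S) →
                            WalkIn G C a b → a ∈ D → b ∈ D
  walk-stays-in-component _ _ (here _) a∈D = a∈D
  walk-stays-in-component D-comp@(_ , _ , _ , closed) C∩S=∅ (step {u} {v} _ u~v rest) u∈D =
    walk-stays-in-component D-comp C∩S=∅ rest (closed u v u∈D (C∩S=∅ v (walk-head rest)) u~v)
    where
    walk-head : ∀ {C a b} → WalkIn G C a b → a ∈ C
    walk-head (here a∈C)     = a∈C
    walk-head (step a∈C _ _) = a∈C

  component-⊆ : ∀ {C D v} → IsComponent G S C → IsComponent G S D → v ∈ C → v ∈ D → C ⊆ D
  component-⊆ {v = v} (_ , C∩S=∅ , connected , _) D-comp v∈C v∈D u∈C =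
    walk-stays-in-component D-comp C∩S=∅ (connected v _ v∈C u∈C) v∈D

  components-disjoint : ∀ {C D v} → IsComponent G S C → IsComponent G S D → C ≢ D →
                        v ∈ C → v ∉ D
  components-disjoint C-comp D-comp C≢D v∈C v∈D =
    C≢D (⊆-antisym (component-⊆ C-comp D-comp v∈C v∈D) (component-⊆ D-comp C-comp v∈D v∈C))

  components-nonadjacent : ∀ {C D u v} → IsComponent G S C → IsComponent G S D → C ≢ D →
                           u ∈ C → v ∈ D → ¬ Adj G u v
  components-nonadjacent C-comp@(_ , _ , _ , closed) D-comp@(_ , D∩S=∅ , _ , _) C≢D u∈C v∈D u~v =
    components-disjoint C-comp D-comp C≢D (closed _ _ u∈C (D∩S=∅ _ v∈D) u~v) v∈D

summands< : ∀ {i d m} → suc i + d ≤ m → i < m × d < m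
summands< {i} {d} 1+i+d≤m = ≤-trans (s≤s (m≤m+n i d)) 1+i+d≤m , ≤-trans (s≤s (m≤n+m d i)) 1+i+d≤m

-- Only vertex 0, …, vertex m are part of the path.
record Path {n} (G : Graph n) (D : Subset n) (A B : Fin n → Set) (m : ℕ) : Set where
  field
    vertex  : ℕ → Fin n
    vertex∈ : ∀ {k} → k ≤ m → vertex k ∈ D
    edge    : ∀ {k} → k < m → Adj G (vertex k) (vertex (suc k))
    start   : A (vertex 0)
    end     : B (vertex m)

record Induced {n} {G : Graph n} {D A B m} (P : Path G D A B m) : Set where
  open Path P
  field
    only-start : ∀ {k} → k ≤ m → A (vertex k) → k ≡ 0
    only-end   : ∀ {k} → k ≤ m → B (vertex k) → k ≡ m
    chordless  : ∀ {i j} → i ≤ m → j ≤ m → Adj G (vertex i) (vertex j) → suc i ≡ j ⊎ suc j ≡ i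
    injective  : ∀ {i j} → i ≤ m → j ≤ m → vertex i ≡ vertex j → i ≡ j

module _ {n} {G : Graph n} {D : Subset n} where

  prepend : ∀ {A A′ B m u} (P : Path G D A′ B m) → u ∈ D → Adj G u (Path.vertex P 0) → A u →
            Path G D A B (suc m)
  prepend {m = m} {u} P u∈D u~P a = record
    { vertex = vertex′ ; vertex∈ = vertex∈′ ; edge = edge′ ; start = a ; end = end }
    where
    open Path P
    vertex′ : ℕ → Fin n
    vertex′ zero    = u
    vertex′ (suc k) = vertex k
    vertex∈′ : ∀ {k} → k ≤ suc m → vertex′ k ∈ D
    vertex∈′ {zero}  _       = u∈D
    vertex∈′ {suc k} (s≤s k≤m) = vertex∈ k≤m
    edge′ : ∀ {k} → k < suc m → Adj G (vertex′ k) (vertex′ (suc k))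
    edge′ {zero}  _       = u~P
    edge′ {suc k} (s≤s k<m) = edge k<m

  walk⇒path : ∀ {A B u v} → WalkIn G D u v → A u → B v → ∃ (Path G D A B)
  walk⇒path (here {u} u∈D) a b =
    0 , record { vertex = λ _ → u ; vertex∈ = λ _ → u∈D ; edge = λ () ; start = a ; end = b }
  walk⇒path (step {v = v} u∈D u~v rest) a b with walk⇒path {A = _≡ v} rest refl b
  ... | m , P = suc m , prepend P u∈D (subst (Adj G _) (sym (Path.start P)) u~v) a

module _ {n} {G : Graph n} {D : Subset n} {A B : Fin n → Set} {m : ℕ} (P : Path G D A B m) where
  open Path P

  prefix : ∀ {k} → k ≤ m → B (vertex k) → Path G D A B k
  prefix k≤m b = record
    { vertex = vertex ; vertex∈ = λ j≤k → vertex∈ (≤-trans j≤k k≤m)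
    ; edge = λ j<k → edge (≤-trans j<k k≤m) ; start = start ; end = b }

  suffix : ∀ {k m′} → m′ + k ≡ m → A (vertex k) → Path G D A B m′
  suffix {k} {m′} m′+k≡m a = record
    { vertex = λ j → vertex (j + k)
    ; vertex∈ = λ j≤m′ → vertex∈ (subst (_ ≤_) m′+k≡m (+-monoˡ-≤ k j≤m′))
    ; edge = λ j<m′ → edge (subst (_ ≤_) m′+k≡m (+-monoˡ-≤ k j<m′))
    ; start = a
    ; end = subst (λ j → B (vertex j)) (sym m′+k≡m) end }

  bypass : ∀ {i d m′} → m′ + d ≡ m → i < m′ → Adj G (vertex i) (vertex (suc i + d)) →
           Path G D A B m′
  bypass {i} {d} {m′} m′+d≡m i<m′ chord = record
    { vertex = vertex′ ; vertex∈ = vertex∈′ ; edge = edge′ ; start = start′ ; end = end′ }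
    where
    vertex′ : ℕ → Fin n
    vertex′ k with k ≤? i
    ... | yes _ = vertex k
    ... | no  _ = vertex (k + d)

    m′≤m : m′ ≤ m
    m′≤m = subst (m′ ≤_) m′+d≡m (m≤m+n m′ d)

    beyond : ∀ {k} → k ≤ m′ → k + d ≤ m
    beyond k≤m′ = subst (_ ≤_) m′+d≡m (+-monoˡ-≤ d k≤m′)

    vertex∈′ : ∀ {k} → k ≤ m′ → vertex′ k ∈ D
    vertex∈′ {k} k≤m′ with k ≤? i
    ... | yes k≤i = vertex∈ (≤-trans k≤i (≤-trans (<⇒≤ i<m′) m′≤m))
    ... | no  _   = vertex∈ (beyond k≤m′)

    edge′ : ∀ {k} → k < m′ → Adj G (vertex′ k) (vertex′ (suc k))
    edge′ {k} k<m′ with k ≤? i | suc k ≤? i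
    ... | yes _   | yes _    = edge (≤-trans k<m′ m′≤m)
    ... | yes k≤i | no  k≮i  = subst (λ j → Adj G (vertex j) (vertex (suc j + d)))
                                      (sym (≤-antisym k≤i (≮⇒≥ k≮i))) chord
    ... | no  k≰i | yes k<i  = ⊥-elim (k≰i (<⇒≤ k<i))
    ... | no  _   | no  _    = edge (beyond k<m′)

    start′ : A (vertex′ 0)
    start′ with 0 ≤? i
    ... | yes _  = start
    ... | no 0≰i = ⊥-elim (0≰i z≤n)

    end′ : B (vertex′ m′)
    end′ with m′ ≤? i
    ... | yes m′≤i = ⊥-elim (<⇒≱ i<m′ m′≤i)
    ... | no  _    = subst (λ j → B (vertex j)) (sym m′+d≡m) end

module Shortening {n} {G : Graph n} {D : Subset n} {A B : Fin n → Set}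
                  (A? : Decidable A) (B? : Decidable B) where

  Shorter : ℕ → Set
  Shorter m = ∃ λ m′ → m′ < m × Path G D A B m′

  module _ {m} (P : Path G D A B m) where
    open Path P

    Repeat : ℕ → ℕ → Set
    Repeat i d = suc i + d ≤ m × vertex i ≡ vertex (suc i + d)

    Chord : ℕ → ℕ → Set
    Chord i d = suc i + suc d ≤ m × Adj G (vertex i) (vertex (suc i + suc d))

    repeat? : ∀ i d → Dec (Repeat i d)
    repeat? i d = (suc i + d ≤? m) ×-dec (vertex i ≟ᶠ vertex (suc i + d))

    chord? : ∀ i d → Dec (Chord i d)
    chord? i d = (suc i + suc d ≤? m) ×-dec T? (Graph.adj G (vertex i) (vertex (suc i + suc d)))

    shorter-by-suffix : ∀ {k} → k < m → A (vertex (suc k)) → Shorter m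
    shorter-by-suffix {k} k<m a = m ∸ suc k , ∸-monoʳ-< (s≤s z≤n) k<m , suffix P (m∸n+n≡m k<m) a

    shorter-by-prefix : ∀ {k} → k < m → B (vertex k) → Shorter m
    shorter-by-prefix k<m b = _ , k<m , prefix P (<⇒≤ k<m) b

    shorter-by-chord : ∀ {i d} → Chord i d → Shorter m
    shorter-by-chord {i} {d} (1+i+1+d≤m , chord) =
      m ∸ suc d , ∸-monoʳ-< (s≤s z≤n) 1+d≤m , bypass P m′+1+d≡m i<m′ chord
      where
      1+d≤m : suc d ≤ m
      1+d≤m = <⇒≤ (proj₂ (summands< 1+i+1+d≤m))
      m′+1+d≡m : m ∸ suc d + suc d ≡ m
      m′+1+d≡m = m∸n+n≡m 1+d≤m
      i<m′ : i < m ∸ suc d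
      i<m′ = +-cancelʳ-< (suc d) i (m ∸ suc d) (subst (i + suc d <_) (sym m′+1+d≡m) 1+i+1+d≤m)

    -- A repeated vertex closes either at the end (so it is an earlier B-vertex)
    -- or before an edge, which is then a chord from its first occurrence.
    shorter-by-repeat : ∀ {i d} → Repeat i d → Shorter m
    shorter-by-repeat {i} {d} (bound , repeat) with m≤n⇒m<n∨m≡n bound
    ... | inj₂ at-end = shorter-by-prefix (proj₁ (summands< bound))
                          (subst B (sym repeat) (subst (λ j → B (vertex j)) (sym at-end) end))
    ... | inj₁ inside = shorter-by-chord {i} {d} (subst (_≤ m) (sym 2+i+d) inside , chord)
      where
      2+i+d : suc i + suc d ≡ suc (suc i + d)
      2+i+d = cong suc (+-suc i d)
      chord : Adj G (vertex i) (vertex (suc i + suc d))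
      chord = subst (λ j → Adj G (vertex i) (vertex j)) (sym 2+i+d)
                (subst (λ v → Adj G v (vertex (suc (suc i + d)))) (sym repeat) (edge inside))

    no-repeat-below : ¬ (∃ λ i → i < m × ∃ λ d → d < m × Repeat i d) → ∀ {i d} → ¬ Repeat i d
    no-repeat-below none r@(1+i+d≤m , _) with summands< 1+i+d≤m
    ... | i<m , d<m = none (_ , i<m , _ , d<m , r)

    no-chord-below : ¬ (∃ λ i → i < m × ∃ λ d → d < m × Chord i d) → ∀ {i d} → ¬ Chord i d
    no-chord-below none c@(1+i+1+d≤m , _) with summands< 1+i+1+d≤m
    ... | i<m , 1+d<m = none (_ , i<m , _ , <-trans (n<1+n _) 1+d<m , c)

    defect-free⇒induced : (∀ {k} → k < m → ¬ A (vertex (suc k))) → (∀ {k} → k < m → ¬ B (vertex k)) →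
                          (∀ {i d} → ¬ Repeat i d) → (∀ {i d} → ¬ Chord i d) → Induced P
    defect-free⇒induced no-late-A no-early-B no-repeat no-chord = record
      { only-start = only-start ; only-end = only-end ; chordless = chordless ; injective = injective }
      where
      only-start : ∀ {k} → k ≤ m → A (vertex k) → k ≡ 0
      only-start {zero}  _   _ = refl
      only-start {suc k} k<m a = ⊥-elim (no-late-A k<m a)

      only-end : ∀ {k} → k ≤ m → B (vertex k) → k ≡ m
      only-end k≤m b with m≤n⇒m<n∨m≡n k≤m
      ... | inj₁ k<m = ⊥-elim (no-early-B k<m b)
      ... | inj₂ k≡m = k≡m

      chordless : ∀ {i j} → i ≤ m → j ≤ m → Adj G (vertex i) (vertex j) → suc i ≡ j ⊎ suc j ≡ i
      chordless {i} {j} i≤m j≤m i~j with compare i j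
      ... | less    _ zero    = inj₁ (cong suc (sym (+-identityʳ i)))
      ... | less    _ (suc _) = ⊥-elim (no-chord (j≤m , i~j))
      ... | equal   _         = ⊥-elim (Adj⇒≢ G i~j refl)
      ... | greater _ zero    = inj₂ (cong suc (sym (+-identityʳ j)))
      ... | greater _ (suc _) = ⊥-elim (no-chord (i≤m , Adj-sym G i~j))

      injective : ∀ {i j} → i ≤ m → j ≤ m → vertex i ≡ vertex j → i ≡ j
      injective {i} {j} i≤m j≤m vᵢ≡vⱼ with compare i j
      ... | less    _ _ = ⊥-elim (no-repeat (j≤m , vᵢ≡vⱼ))
      ... | equal   _   = refl
      ... | greater _ _ = ⊥-elim (no-repeat (i≤m , sym vᵢ≡vⱼ))

    shorter-or-induced : Shorter m ⊎ Induced P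
    shorter-or-induced with anyUpTo? (λ k → A? (vertex (suc k))) m
    ... | yes (_ , k<m , a) = inj₁ (shorter-by-suffix k<m a)
    ... | no no-late-A with anyUpTo? (λ k → B? (vertex k)) m
    ... | yes (_ , k<m , b) = inj₁ (shorter-by-prefix k<m b)
    ... | no no-early-B with anyUpTo? (λ i → anyUpTo? (λ d → repeat? i d) m) m
    ... | yes (_ , _ , _ , _ , r) = inj₁ (shorter-by-repeat r)
    ... | no no-repeat with anyUpTo? (λ i → anyUpTo? (λ d → chord? i d) m) m
    ... | yes (_ , _ , _ , _ , c) = inj₁ (shorter-by-chord c)
    ... | no no-chord = inj₂ (defect-free⇒induced
            (λ k<m a → no-late-A (_ , k<m , a)) (λ k<m b → no-early-B (_ , k<m , b))
            (no-repeat-below no-repeat) (no-chord-below no-chord))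

  InducedPath : Set
  InducedPath = ∃ λ m → Σ (Path G D A B m) Induced

  induced-path : ∀ {m} → Path G D A B m → InducedPath
  induced-path {m} = <-rec (λ m → Path G D A B m → InducedPath) shorten m
    where
    shorten : ∀ m → (∀ {m′} → m′ < m → Path G D A B m′ → InducedPath) → Path G D A B m → InducedPath
    shorten m rec P with shorter-or-induced P
    ... | inj₁ (_ , m′<m , P′) = rec m′<m P′
    ... | inj₂ induced         = m , P , induced

-- CycAdj G k i j unfolds to Consecutive k (toℕ i) (toℕ j).
Consecutive : ℕ → ℕ → ℕ → Set
Consecutive k i j = suc i ≡ j ⊎ suc j ≡ i ⊎ (i ≡ 0 × suc j ≡ k) ⊎ (j ≡ 0 × suc i ≡ k)

Consecutive-sym : ∀ {k i j} → Consecutive k i j → Consecutive k j i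
Consecutive-sym (inj₁ i+1≡j)                = inj₂ (inj₁ i+1≡j)
Consecutive-sym (inj₂ (inj₁ j+1≡i))         = inj₁ j+1≡i
Consecutive-sym (inj₂ (inj₂ (inj₁ closing))) = inj₂ (inj₂ (inj₂ closing))
Consecutive-sym (inj₂ (inj₂ (inj₂ closing))) = inj₂ (inj₂ (inj₁ closing))

pattern s≤s⁵ h = s≤s (s≤s (s≤s (s≤s (s≤s h))))

module Gluing {n} {G : Graph n} {D : Subset n} {a₀ a₁ a₂ a₃ : Fin n}
  (a₀~a₁ : Adj G a₀ a₁) (a₁~a₂ : Adj G a₁ a₂) (a₂~a₃ : Adj G a₂ a₃)
  (a₀≁a₂ : ¬ Adj G a₀ a₂) (a₀≁a₃ : ¬ Adj G a₀ a₃) (a₁≁a₃ : ¬ Adj G a₁ a₃)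
  (a₀∉D : a₀ ∉ D) (a₁∉D : a₁ ∉ D) (a₂∉D : a₂ ∉ D) (a₃∉D : a₃ ∉ D)
  (a₁≁D : ∀ {v} → v ∈ D → ¬ Adj G a₁ v) (a₂≁D : ∀ {v} → v ∈ D → ¬ Adj G a₂ v) where

  module _ {m} (P : Path G D (Adj G a₃) (Adj G a₀) m) where
    open Path P

    cycle : ℕ → Fin n
    cycle 0                          = a₀
    cycle 1                          = a₁
    cycle 2                          = a₂
    cycle 3                          = a₃
    cycle (suc (suc (suc (suc k)))) = vertex k

    cycle-edge : ∀ a → suc a < 5 + m → Adj G (cycle a) (cycle (suc a))
    cycle-edge 0 _                                = a₀~a₁
    cycle-edge 1 _                                = a₁~a₂
    cycle-edge 2 _                                = a₂~a₃
    cycle-edge 3 _                                = start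
    cycle-edge (suc (suc (suc (suc k)))) (s≤s⁵ k<m) = edge k<m

    consecutive⇒adjacent : ∀ {a b} → a < 5 + m → b < 5 + m → Consecutive (5 + m) a b →
                           Adj G (cycle a) (cycle b)
    consecutive⇒adjacent _   b<K (inj₁ refl)                     = cycle-edge _ b<K
    consecutive⇒adjacent a<K _   (inj₂ (inj₁ refl))              = Adj-sym G (cycle-edge _ a<K)
    consecutive⇒adjacent _   _   (inj₂ (inj₂ (inj₁ (refl , refl)))) = end
    consecutive⇒adjacent _   _   (inj₂ (inj₂ (inj₂ (refl , refl)))) = Adj-sym G end

    module _ (I : Induced P) where
      open Induced I

      ∉D⇒≢vertex : ∀ {a k} → a ∉ D → k ≤ m → a ≢ vertex k
      ∉D⇒≢vertex a∉D k≤m a≡v = a∉D (subst (_∈ D) (sym a≡v) (vertex∈ k≤m))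

      distinct : ∀ a d → suc a + d < 5 + m → cycle a ≢ cycle (suc a + d)
      distinct 0 0 _                        = Adj⇒≢ G a₀~a₁
      distinct 0 1 _ a₀≡a₂                  = a₀≁a₃ (subst (λ v → Adj G v a₃) (sym a₀≡a₂) a₂~a₃)
      distinct 0 2 _ a₀≡a₃                  = a₀≁a₂ (Adj-sym G (subst (Adj G a₂) (sym a₀≡a₃) a₂~a₃))
      distinct 0 (suc (suc (suc k))) (s≤s⁵ k≤m) = ∉D⇒≢vertex a₀∉D k≤m
      distinct 1 0 _                        = Adj⇒≢ G a₁~a₂
      distinct 1 1 _ a₁≡a₃                  = a₀≁a₃ (subst (Adj G a₀) a₁≡a₃ a₀~a₁)
      distinct 1 (suc (suc k)) (s≤s⁵ k≤m)   = ∉D⇒≢vertex a₁∉D k≤m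
      distinct 2 0 _                        = Adj⇒≢ G a₂~a₃
      distinct 2 (suc k) (s≤s⁵ k≤m)         = ∉D⇒≢vertex a₂∉D k≤m
      distinct 3 k (s≤s⁵ k≤m)               = ∉D⇒≢vertex a₃∉D k≤m
      distinct (suc (suc (suc (suc i)))) d (s≤s⁵ j≤m) vᵢ≡vⱼ =
        m≢1+m+n i (injective (≤-trans (m≤m+n i d) (<⇒≤ j≤m)) j≤m vᵢ≡vⱼ)

      cycle-injective : ∀ {a b} → a < 5 + m → b < 5 + m → cycle a ≡ cycle b → a ≡ b
      cycle-injective {a} {b} a<K b<K ca≡cb with compare a b
      ... | less    _ d = ⊥-elim (distinct a d b<K ca≡cb)
      ... | equal   _   = refl
      ... | greater _ d = ⊥-elim (distinct b d a<K (sym ca≡cb))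

      adjacent-forward : ∀ a d → suc a + d < 5 + m → Adj G (cycle a) (cycle (suc a + d)) →
                         Consecutive (5 + m) a (suc a + d)
      adjacent-forward 0 0 _ _                               = inj₁ refl
      adjacent-forward 0 1 _ a₀~a₂                           = ⊥-elim (a₀≁a₂ a₀~a₂)
      adjacent-forward 0 2 _ a₀~a₃                           = ⊥-elim (a₀≁a₃ a₀~a₃)
      adjacent-forward 0 (suc (suc (suc k))) (s≤s⁵ k≤m) a₀~v with only-end k≤m a₀~v
      ... | refl = inj₂ (inj₂ (inj₁ (refl , refl)))
      adjacent-forward 1 0 _ _                               = inj₁ refl
      adjacent-forward 1 1 _ a₁~a₃                           = ⊥-elim (a₁≁a₃ a₁~a₃)
      adjacent-forward 1 (suc (suc k)) (s≤s⁵ k≤m) a₁~v        = ⊥-elim (a₁≁D (vertex∈ k≤m) a₁~v)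
      adjacent-forward 2 0 _ _                               = inj₁ refl
      adjacent-forward 2 (suc k) (s≤s⁵ k≤m) a₂~v              = ⊥-elim (a₂≁D (vertex∈ k≤m) a₂~v)
      adjacent-forward 3 k (s≤s⁵ k≤m) a₃~v with only-start k≤m a₃~v
      ... | refl = inj₁ refl
      adjacent-forward (suc (suc (suc (suc i)))) d (s≤s⁵ j≤m) vᵢ~vⱼ
        with chordless (≤-trans (m≤m+n i d) (<⇒≤ j≤m)) j≤m vᵢ~vⱼ
      ... | inj₁ i+1≡j = inj₁ (cong (4 +_) i+1≡j)
      ... | inj₂ j+1≡i = inj₂ (inj₁ (cong (4 +_) j+1≡i))

      adjacent⇒consecutive : ∀ {a b} → a < 5 + m → b < 5 + m → Adj G (cycle a) (cycle b) →
                             Consecutive (5 + m) a b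
      adjacent⇒consecutive {a} {b} a<K b<K ca~cb with compare a b
      ... | less    _ d = adjacent-forward a d b<K ca~cb
      ... | equal   _   = ⊥-elim (Adj⇒≢ G ca~cb refl)
      ... | greater _ d = Consecutive-sym (adjacent-forward b d a<K (Adj-sym G ca~cb))

      glued-hole : IsHole G (5 + m) (λ i → cycle (toℕ i))
      glued-hole =
          s≤s (s≤s (s≤s (s≤s z≤n)))
        , (λ i j ci≡cj → toℕ-injective (cycle-injective (toℕ<n i) (toℕ<n j) ci≡cj))
        , λ i j → mk⇔ (adjacent⇒consecutive (toℕ<n i) (toℕ<n j))
                      (consecutive⇒adjacent (toℕ<n i) (toℕ<n j))

  module _ {P : Path G D (Adj G a₃) (Adj G a₀) 0} (I : Induced P)
           {g : Fin n} (g∈D : g ∈ D) (a₃~g : Adj G a₃ g) (a₀≁g : ¬ Adj G a₀ g) where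
    open Path P

    C5 : Fin 5 → Fin n
    C5 i = cycle P (toℕ i)

    three four : Fin 5
    three = fs (fs (fs fz))
    four  = fs (fs (fs (fs fz)))

    g∉C5 : ∀ i → ¬ (g ≡ C5 i)
    g∉C5 fz                     g≡a₀ = a₀∉D (subst (_∈ D) g≡a₀ g∈D)
    g∉C5 (fs fz)                g≡a₁ = a₁∉D (subst (_∈ D) g≡a₁ g∈D)
    g∉C5 (fs (fs fz))           g≡a₂ = a₂∉D (subst (_∈ D) g≡a₂ g∈D)
    g∉C5 (fs (fs (fs fz)))      g≡a₃ = a₃∉D (subst (_∈ D) g≡a₃ g∈D)
    g∉C5 (fs (fs (fs (fs fz)))) g≡v₀ = a₀≁g (subst (Adj G a₀) (sym g≡v₀) end)

    g-neighbours : ∀ i → Adj G g (C5 i) → i ≡ three ⊎ i ≡ four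
    g-neighbours fz                     g~a₀ = ⊥-elim (a₀≁g (Adj-sym G g~a₀))
    g-neighbours (fs fz)                g~a₁ = ⊥-elim (a₁≁D g∈D (Adj-sym G g~a₁))
    g-neighbours (fs (fs fz))           g~a₂ = ⊥-elim (a₂≁D g∈D (Adj-sym G g~a₂))
    g-neighbours (fs (fs (fs fz)))      _    = inj₁ refl
    g-neighbours (fs (fs (fs (fs fz)))) _    = inj₂ refl

    g-neighbours-without-v₀ : ¬ Adj G g (vertex 0) → ∀ i → Adj G g (C5 i) → i ≡ three
    g-neighbours-without-v₀ g≁v₀ i g~i with g-neighbours i g~i
    ... | inj₁ i≡3  = i≡3
    ... | inj₂ refl = ⊥-elim (g≁v₀ g~i)

    g~three : ∀ i → i ≡ three → Adj G g (C5 i)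
    g~three _ refl = Adj-sym G a₃~g

    g~three-four : Adj G g (vertex 0) → ∀ i → i ≡ three ⊎ i ≡ four → Adj G g (C5 i)
    g~three-four _    i (inj₁ i≡3)  = g~three i i≡3
    g~three-four g~v₀ _ (inj₂ refl) = g~v₀

    glued-extended-C5 : HasExtendedC5 G
    glued-extended-C5 with T? (Graph.adj G g (vertex 0))
    ... | yes g~v₀ = C5 , g , glued-hole P I , g∉C5 , inj₂ (three , four , inj₁ refl ,
                       λ i → mk⇔ (g-neighbours i) (g~three-four g~v₀ i))
    ... | no  g≁v₀ = C5 , g , glued-hole P I , g∉C5 , inj₁ (three ,
                       λ i → mk⇔ (g-neighbours-without-v₀ g≁v₀ i) (g~three i))

module _ {n} {G : Graph n} (G∈𝒞 : InClassC G) {S L R : Subset n}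
         (L-full : IsFullComponent G S L) (R-full : IsFullComponent G S R) (L≢R : L ≢ R) where

  L∩S=∅ : ∀ {v} → v ∈ L → v ∉ S
  L∩S=∅ = proj₁ (proj₂ (proj₁ L-full)) _

  S∩R=∅ : ∀ {v} → v ∈ S → v ∉ R
  S∩R=∅ v∈S v∈R = proj₁ (proj₂ (proj₁ R-full)) _ v∈R v∈S

  L∩R=∅ : ∀ {v} → v ∈ L → v ∉ R
  L∩R=∅ = components-disjoint (proj₁ L-full) (proj₁ R-full) L≢R

  L≁R : ∀ {u} → u ∈ L → ∀ {v} → v ∈ R → ¬ Adj G u v
  L≁R u∈L v∈R = components-nonadjacent (proj₁ L-full) (proj₁ R-full) L≢R u∈L v∈R

  S⊆N[R] : ∀ {v} → v ∈ S → N G R v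
  S⊆N[R] {v} = Equivalence.to (proj₂ R-full v)

  R-connected : ConnectedSet G R
  R-connected = proj₁ (proj₂ (proj₂ (proj₁ R-full)))

  private-triple-not-missed : ∀ {Z z f g x} → Z ⊆ L → IsClique G Z → (∀ s → s ∈ S → N G Z s) →
                              z ∈ Z → Private G S Z z f → g ∈ R → Adj G f g → x ∈ S →
                              ¬ Adj G x z → ¬ Adj G x f → ¬ Adj G x g → ⊥
  private-triple-not-missed {Z} {z} {f} {x = x} Z⊆L Z-clique S⊆N[Z] z∈Z (z~f , f∈S , f-private)
                            g∈R f~g x∈S x≁z x≁f x≁g =
    close-up (S⊆N[Z] x x∈S) (S⊆N[R] f∈S) (S⊆N[R] x∈S)
    where
    close-up : N G Z x → N G R f → N G R x → ⊥
    close-up (_ , z₁ , z₁∈Z , z₁~x) (_ , r₀ , r₀∈R , r₀~f) (_ , rₘ , rₘ∈R , rₘ~x) =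
      glued-contradiction (proj₂ (proj₂ (Shortening.induced-path (Adj? G f) (Adj? G x)
        (proj₂ (walk⇒path (R-connected r₀ rₘ r₀∈R rₘ∈R) (Adj-sym G r₀~f) (Adj-sym G rₘ~x))))))
      where
      z₁≢z : z₁ ≢ z
      z₁≢z refl = x≁z (Adj-sym G z₁~x)

      f∉Z-z : f ∉ Z ─ ⁅ z ⁆
      f∉Z-z f∈Z = L∩S=∅ (Z⊆L (p─q⊆p Z ⁅ z ⁆ f∈Z)) f∈S

      z₁≁f : ¬ Adj G z₁ f
      z₁≁f z₁~f = f-private (f∉Z-z , z₁ , x∈p∧x∉q⇒x∈p─q z₁∈Z (x≢y⇒x∉⁅y⁆ z₁≢z) , z₁~f)

      open Gluing {D = R} (Adj-sym G z₁~x) (Z-clique z₁ z z₁∈Z z∈Z z₁≢z) z~f x≁z x≁f z₁≁f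
                  (S∩R=∅ x∈S) (L∩R=∅ (Z⊆L z₁∈Z)) (L∩R=∅ (Z⊆L z∈Z)) (S∩R=∅ f∈S)
                  (L≁R (Z⊆L z₁∈Z)) (L≁R (Z⊆L z∈Z))

      glued-contradiction : ∀ {m} {P : Path G R (Adj G f) (Adj G x) m} → Induced P → ⊥
      glued-contradiction {zero}      I = proj₂ G∈𝒞 (glued-extended-C5 I g∈R f~g x≁g)
      glued-contradiction {suc m} {P} I = proj₁ G∈𝒞 (6 + m) _ (m≤m+n 6 m) (glued-hole P I)

  private-triple-seen : ∀ {Z z f g x} → Z ⊆ L → IsClique G Z → (∀ s → s ∈ S → N G Z s) →
                        z ∈ Z → Private G S Z z f → g ∈ R → Adj G f g → x ∈ S →
                        Adj G x z ⊎ Adj G x f ⊎ Adj G x g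
  private-triple-seen {z = z} {f} {g} {x} Z⊆L Z-clique S⊆N[Z] z∈Z f-private g∈R f~g x∈S
    with Adj? G x z | Adj? G x f | Adj? G x g
  ... | yes x~z | _       | _       = inj₁ x~z
  ... | no  _   | yes x~f | _       = inj₂ (inj₁ x~f)
  ... | no  _   | no  _   | yes x~g = inj₂ (inj₂ x~g)
  ... | no  x≁z | no  x≁f | no  x≁g = ⊥-elim (private-triple-not-missed
          Z⊆L Z-clique S⊆N[Z] z∈Z f-private g∈R f~g x∈S x≁z x≁f x≁g)

lemma3p4 : ∀ {n} (G : Graph n) → InClassC G →
    (S : Subset n) → IsMinimalSeparator G S →
    (L R : Subset n) → IsFullComponent G S L → IsFullComponent G S R → ¬ (L ≡ R) →
    (Z : Subset n) → Z ⊆ L → IsClique G Z → (∀ s → s ∈ S → N G Z s) →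
    (∀ z → z ∈ Z → ∃ λ s → Private G S Z z s) →
    (Z′ : Subset n) → Z′ ⊆ R → IsClique G Z′ → (∀ s → s ∈ S → N G Z′ s) →
    (∀ z → z ∈ Z′ → ∃ λ s → Private G S Z′ z s) →
    (f g : Fin n → Fin n) →
    (∀ z → z ∈ Z → Private G S Z z (f z) × g z ∈ R × Adj G (f z) (g z)) →
    (∀ z → z ∈ Z′ → Private G S Z′ z (f z) × g z ∈ L × Adj G (f z) (g z)) →
    ∀ x z → x ∈ S → (z ∈ Z ⊎ z ∈ Z′) →
    Adj G x z ⊎ Adj G x (f z) ⊎ Adj G x (g z)
lemma3p4 G G∈𝒞 S _ L R L-full R-full L≢R Z Z⊆L Z-clique S⊆N[Z] _ Z′ Z′⊆R Z′-clique S⊆N[Z′] _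
         f g fg-Z fg-Z′ x z x∈S (inj₁ z∈Z) =
  let f-private , g∈R , f~g = fg-Z z z∈Z in
  private-triple-seen G∈𝒞 L-full R-full L≢R Z⊆L Z-clique S⊆N[Z] z∈Z f-private g∈R f~g x∈S
lemma3p4 G G∈𝒞 S _ L R L-full R-full L≢R Z Z⊆L Z-clique S⊆N[Z] _ Z′ Z′⊆R Z′-clique S⊆N[Z′] _
         f g fg-Z fg-Z′ x z x∈S (inj₂ z∈Z′) =
  let f-private , g∈L , f~g = fg-Z′ z z∈Z′ in
  private-triple-seen G∈𝒞 R-full L-full (λ R≡L → L≢R (sym R≡L)) Z′⊆R Z′-clique S⊆N[Z′] z∈Z′
    f-private g∈L f~g x∈S
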